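{- For every positive integer $n$, the expected number of leaves in a labeled plane 1-2 tree on vertex set $[n]$ chosen uniformly at random is at least $n/4$.
   Context: A labeled plane 1-2 tree on vertex set $[n]=\{1,\dots,n\}$ is a rooted tree whose vertices are bijectively labeled by $[n]$, in which every vertex has at most two children, the label of each non-root vertex is less than the label of its parent, and the children of each vertex are linearly ordered. A leaf is a vertex with no children. -}

module Defs where

open import Data.Nat using (ℕ; suc; _+_; _<_)
open import Data.List using (List; []; _∷_; _++_; map; upTo)
open import Data.Product using (_×_)
open import Data.Unit using (⊤)
open import Data.List.Relation.Binary.Permutation.Propositional using (_↭_)

data PTree : Set where
  leaf  : ℕ → PTree
  node₁ : ℕ → PTree → PTree
  node₂ : ℕ → PTree → PTree → PTree

label : PTree → ℕ
label (leaf a)      = a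
label (node₁ a _)   = a
label (node₂ a _ _) = a

labels : PTree → List ℕ
labels (leaf a)      = a ∷ []
labels (node₁ a t)   = a ∷ labels t
labels (node₂ a l r) = a ∷ labels l ++ labels r

leafCount : PTree → ℕ
leafCount (leaf _)      = 1
leafCount (node₁ _ t)   = leafCount t
leafCount (node₂ _ l r) = leafCount l + leafCount r

Decreasing : PTree → Set
Decreasing (leaf _)      = ⊤
Decreasing (node₁ a t)   = (label t < a) × Decreasing t
Decreasing (node₂ a l r) = (label l < a) × (label r < a) × Decreasing l × Decreasing r

[_] : ℕ → List ℕ
[ n ] = map suc (upTo n)

-- t is a labeled plane 1-2 tree on vertex set [n]:
-- labels are bijective with [n] (each of 1..n used exactly once) and decrease away from the root
IsLabeled12Tree : ℕ → PTree → Set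
IsLabeled12Tree n t = (labels t ↭ [ n ]) × Decreasing t

module Submission where

open import Defs
open import Data.Nat using (ℕ; _*_; _≤_)
open import Data.List using (List; length; map)
open import Data.Nat.ListAction using (sum)
open import Data.List.Membership.Propositional using (_∈_)
open import Data.List.Relation.Unary.Unique.Propositional using (Unique)
open import Function.Bundles using (_⇔_)

open import Data.Nat using (zero; suc; _+_; _<_; _>_; z≤n; s≤s)
open import Data.Nat.Properties
open import Data.Nat.ListAction.Properties using (sum-++; sum-↭)
open import Data.Nat.Solver using (module +-*-Solver)
open +-*-Solver using (solve; _:=_; _:+_; _:*_; con)
open import Algebra.Properties.CommutativeSemigroup +-commutativeSemigroup using (interchange)
open import Data.Empty using (⊥-elim)
open import Data.Unit using (tt)
open import Data.Product using (_×_; _,_; proj₁; proj₂; ∃; ∃₂; map₁; map₂)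
open import Data.Sum using (inj₁; inj₂)
open import Data.List using ([]; _∷_; _++_; concatMap; cartesianProductWith; upTo; downFrom)
open import Data.List.Properties using (length-++; length-map; map-++; map-∘; map-cong; length-downFrom; reverse-upTo)
open import Data.List.Membership.Propositional using (find; lose)
open import Data.List.Membership.Propositional.Properties
  using (∈-++⁺ˡ; ∈-++⁺ʳ; ∈-++⁻; ∈-map⁺; ∈-map⁻; ∈-∃++; ∈-concatMap⁺; ∈-concatMap⁻;
         ∈-cartesianProductWith⁺; ∈-cartesianProductWith⁻)
open import Data.List.Membership.Propositional.Properties.WithK using (unique∧set⇒bag)
open import Data.List.Relation.Unary.Any using (here; there)
open import Data.List.Relation.Unary.All using (All; []; _∷_)
import Data.List.Relation.Unary.All as All
import Data.List.Relation.Unary.All.Properties as AllP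
open import Data.List.Relation.Unary.AllPairs using (AllPairs; []; _∷_)
import Data.List.Relation.Unary.AllPairs as AllPairs
import Data.List.Relation.Unary.AllPairs.Properties as AllPairsP
import Data.List.Relation.Unary.Unique.Propositional.Properties as UniqueP
open import Data.List.Relation.Binary.Disjoint.Propositional using (Disjoint)
open import Data.List.Relation.Binary.BagAndSetEquality using (∼bag⇒↭)
open import Data.List.Relation.Binary.Permutation.Propositional
  using (_↭_; ↭-refl; ↭-sym; ↭-trans; ↭-prep; ↭-reflexive)
open import Data.List.Relation.Binary.Permutation.Propositional.Properties
  using (∈-resp-↭; ↭-empty-inv; ↭-singleton-inv; shift; drop-∷; ++⁺; ++⁺ˡ; ++⁺ʳ; ↭-length; ↭-reverse; map⁺)
open import Data.List.Relation.Ternary.Interleaving.Propositional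
  using (Interleaving; []; consˡ; consʳ; toPermutation)
open import Data.List.Relation.Ternary.Interleaving.Properties using (interleave-length)
open import Function.Bundles using (mk⇔)
import Function.Properties.Equivalence as ⇔
open import Relation.Binary.PropositionalEquality using (_≡_; refl; sym; trans; cong; cong₂; subst; module ≡-Reasoning)
open import Relation.Nullary using (¬_)

-- Build the trees recursively from the root: on a descending list of labels
-- m ∷ S the root gets the largest label m, and is a leaf (S empty), has one subtree on
-- S, or has two subtrees on the two parts of a split of S.  Writing count and leaves
-- for the number of such trees and their total number of leaves, we prove the
-- stronger invariant  (|S| + 2) * count ≤ 4 * leaves  by induction, using the
-- recurrences for count and leaves and the fact that, on at least two labels,
-- one-child roots are no more frequent than two-child roots.

private
  variable
    A B C : Set
    xs ys zs : List A

total : (A → ℕ) → List A → ℕ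
total f xs = sum (map f xs)

total-++ : (f : A → ℕ) (xs ys : List A) → total f (xs ++ ys) ≡ total f xs + total f ys
total-++ f xs ys = trans (cong sum (map-++ f xs ys)) (sum-++ (map f xs) (map f ys))

total-map : (f : B → ℕ) (g : A → B) (xs : List A) → total f (map g xs) ≡ total (λ x → f (g x)) xs
total-map f g xs = cong sum (sym (map-∘ xs))

total-cong : {f g : A → ℕ} → (∀ x → f x ≡ g x) → (xs : List A) → total f xs ≡ total g xs
total-cong f≗g xs = cong sum (map-cong f≗g xs)

total-concatMap : (f : B → ℕ) (g : A → List B) (xs : List A) →
                  total f (concatMap g xs) ≡ total (λ x → total f (g x)) xs
total-concatMap f g []       = refl
total-concatMap f g (x ∷ xs) = trans (total-++ f (g x) _) (cong (total f (g x) +_) (total-concatMap f g xs))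

length-concatMap : (g : A → List B) (xs : List A) → length (concatMap g xs) ≡ total (λ x → length (g x)) xs
length-concatMap g []       = refl
length-concatMap g (x ∷ xs) = trans (length-++ (g x)) (cong (length (g x) +_) (length-concatMap g xs))

total-+ : (f g : A → ℕ) (xs : List A) → total (λ x → f x + g x) xs ≡ total f xs + total g xs
total-+ f g []       = refl
total-+ f g (x ∷ xs) =
  trans (cong (f x + g x +_) (total-+ f g xs)) (interchange (f x) (g x) (total f xs) (total g xs))

total-scale : (c : ℕ) (f : A → ℕ) (xs : List A) → total (λ x → c * f x) xs ≡ c * total f xs
total-scale c f []       = sym (*-zeroʳ c)
total-scale c f (x ∷ xs) = trans (cong (c * f x +_) (total-scale c f xs)) (sym (*-distribˡ-+ c (f x) _))

total-const : (c : ℕ) (xs : List A) → total (λ _ → c) xs ≡ length xs * c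
total-const c []       = refl
total-const c (x ∷ xs) = cong (c +_) (total-const c xs)

total-mono : {f g : A → ℕ} {xs : List A} → All (λ x → f x ≤ g x) xs → total f xs ≤ total g xs
total-mono []       = z≤n
total-mono (h ∷ hs) = +-mono-≤ h (total-mono hs)

total-mono-≤ : {f g : A → ℕ} → (∀ x → f x ≤ g x) → (xs : List A) → total f xs ≤ total g xs
total-mono-≤ f≤g xs = total-mono {xs = xs} (All.tabulate (λ {x} _ → f≤g x))

∈⇒≤total : (f : A → ℕ) {x : A} {xs : List A} → x ∈ xs → f x ≤ total f xs
∈⇒≤total f {xs = y ∷ ys} (here refl) = m≤m+n (f y) _
∈⇒≤total f {xs = y ∷ ys} (there x∈) = ≤-trans (∈⇒≤total f x∈) (m≤n+m _ (f y))

length-cartesianProductWith : (f : A → B → C) (xs : List A) (ys : List B) →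
                              length (cartesianProductWith f xs ys) ≡ length xs * length ys
length-cartesianProductWith f []       ys = refl
length-cartesianProductWith f (x ∷ xs) ys =
  trans (length-++ (map (f x) ys)) (cong₂ _+_ (length-map (f x) ys) (length-cartesianProductWith f xs ys))

total-cartesianProductWith : (f : A → B → C) (w : C → ℕ) (u : A → ℕ) (v : B → ℕ) →
  (∀ a b → w (f a b) ≡ u a + v b) → (xs : List A) (ys : List B) →
  total w (cartesianProductWith f xs ys) ≡ total u xs * length ys + length xs * total v ys
total-cartesianProductWith f w u v additive []       ys = refl
total-cartesianProductWith f w u v additive (x ∷ xs) ys = begin
  total w (map (f x) ys ++ cartesianProductWith f xs ys)
    ≡⟨ total-++ w (map (f x) ys) _ ⟩
  total w (map (f x) ys) + total w (cartesianProductWith f xs ys)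
    ≡⟨ cong₂ _+_ row (total-cartesianProductWith f w u v additive xs ys) ⟩
  (length ys * u x + total v ys) + (total u xs * length ys + length xs * total v ys)
    ≡⟨ solve 5 (λ a p q b c → (q :* a :+ b) :+ (p :* q :+ c :* b) := (a :+ p) :* q :+ (b :+ c :* b))
             refl (u x) (total u xs) (length ys) (total v ys) (length xs) ⟩
  (u x + total u xs) * length ys + (total v ys + length xs * total v ys) ∎
  where
  open ≡-Reasoning
  row : total w (map (f x) ys) ≡ length ys * u x + total v ys
  row = begin
    total w (map (f x) ys)          ≡⟨ total-map w (f x) ys ⟩
    total (λ y → w (f x y)) ys      ≡⟨ total-cong (additive x) ys ⟩
    total (λ y → u x + v y) ys      ≡⟨ total-+ (λ _ → u x) v ys ⟩
    total (λ _ → u x) ys + total v ys ≡⟨ cong (_+ total v ys) (total-const (u x) ys) ⟩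
    length ys * u x + total v ys    ∎

splits : List A → List (List A × List A)
splits []       = ([] , []) ∷ []
splits (x ∷ xs) = map (map₁ (x ∷_)) (splits xs) ++ map (map₂ (x ∷_)) (splits xs)

splits-interleaving : (zs : List A) → All (λ q → Interleaving (proj₁ q) (proj₂ q) zs) (splits zs)
splits-interleaving []       = [] ∷ []
splits-interleaving (z ∷ zs) =
  AllP.++⁺ (AllP.map⁺ (All.map consˡ rest)) (AllP.map⁺ (All.map consʳ rest))
  where rest = splits-interleaving zs

interleaving∈splits : Interleaving xs ys zs → (xs , ys) ∈ splits zs
interleaving∈splits []        = here refl
interleaving∈splits (consˡ i) = ∈-++⁺ˡ (∈-map⁺ (map₁ (_ ∷_)) (interleaving∈splits i))
interleaving∈splits {zs = z ∷ zs} (consʳ i) =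
  ∈-++⁺ʳ (map (map₁ (z ∷_)) (splits zs)) (∈-map⁺ (map₂ (z ∷_)) (interleaving∈splits i))

All-interleaving : {P : A → Set} → All P zs → Interleaving xs ys zs → All P xs × All P ys
All-interleaving []         []        = [] , []
All-interleaving (pz ∷ pzs) (consˡ i) = let pxs , pys = All-interleaving pzs i in pz ∷ pxs , pys
All-interleaving (pz ∷ pzs) (consʳ i) = let pxs , pys = All-interleaving pzs i in pxs , pz ∷ pys

AllPairs-interleaving : {R : A → A → Set} → AllPairs R zs → Interleaving xs ys zs →
                        AllPairs R xs × AllPairs R ys
AllPairs-interleaving []         []        = [] , []
AllPairs-interleaving (rz ∷ rzs) (consˡ i) =
  let rxs , rys = AllPairs-interleaving rzs i in proj₁ (All-interleaving rz i) ∷ rxs , rys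
AllPairs-interleaving (rz ∷ rzs) (consʳ i) =
  let rxs , rys = AllPairs-interleaving rzs i in rxs , proj₂ (All-interleaving rz i) ∷ rys

↭⇒interleaving : (zs : List A) → xs ++ ys ↭ zs →
                 ∃₂ λ xs′ ys′ → Interleaving xs′ ys′ zs × xs ↭ xs′ × ys ↭ ys′
↭⇒interleaving {xs = []}    {ys = []}    [] p = [] , [] , [] , ↭-refl , ↭-refl
↭⇒interleaving {xs = _ ∷ _}              [] p with () ← ↭-empty-inv p
↭⇒interleaving {xs = []}    {ys = _ ∷ _} [] p with () ← ↭-empty-inv p
↭⇒interleaving {xs = xs} {ys} (z ∷ zs) p with ∈-++⁻ xs (∈-resp-↭ (↭-sym p) (here refl))
... | inj₁ z∈xs with u , v , refl ← ∈-∃++ z∈xs =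
  let xs′ , ys′ , i , pxs , pys = ↭⇒interleaving zs (drop-∷ (↭-trans (↭-sym (++⁺ʳ ys (shift z u v))) p))
  in  z ∷ xs′ , ys′ , consˡ i , ↭-trans (shift z u v) (↭-prep z pxs) , pys
... | inj₂ z∈ys with u , v , refl ← ∈-∃++ z∈ys =
  let xs′ , ys′ , i , pxs , pys = ↭⇒interleaving zs
        (drop-∷ (↭-trans (↭-sym (shift z xs (u ++ v))) (↭-trans (↭-sym (++⁺ˡ xs (shift z u v))) p)))
  in  xs′ , z ∷ ys′ , consʳ i , pxs , ↭-trans (shift z u v) (↭-prep z pys)

-- For a list without repetitions, left parts of distinct splits are never rearrangements
-- of each other: the first entry lies in the left parts of exactly the first half of the splits.
splits-separated : Unique zs → AllPairs (λ q q′ → ¬ (proj₁ q ↭ proj₁ q′)) (splits zs)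
splits-separated {zs = []}     []          = [] ∷ []
splits-separated {zs = z ∷ zs} (z∉zs ∷ u) =
  AllPairsP.++⁺ (AllPairsP.map⁺ (AllPairs.map (λ ≭ p → ≭ (drop-∷ p)) rest))
                (AllPairsP.map⁺ rest)
                (AllP.map⁺ (All.tabulate (λ _ → AllP.map⁺ (All.map z∉left (splits-interleaving zs)))))
  where
  rest = splits-separated u
  z∉left : ∀ {q xs} → Interleaving (proj₁ q) (proj₂ q) zs → ¬ (z ∷ xs ↭ proj₁ q)
  z∉left i p with z∈ ← ∈-resp-↭ p (here refl) = All.lookup (proj₁ (All-interleaving z∉zs i)) z∈ refl

allRight : (zs : List A) → Interleaving [] zs zs
allRight []       = []
allRight (z ∷ zs) = consʳ (allRight zs)

onlyRoot : List ℕ → ℕ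
onlyRoot []      = 1
onlyRoot (_ ∷ _) = 0

leafIf : ℕ → List ℕ → List PTree
leafIf m []      = leaf m ∷ []
leafIf m (_ ∷ _) = []

forks : ℕ → (List ℕ → List PTree) → List ℕ × List ℕ → List PTree
forks m enum (A , B) = cartesianProductWith (node₂ m) (enum A) (enum B)

-- trees k S lists the decreasing trees of height < k whose labels are the entries of the
-- descending list S: the root carries the largest label m, and the remaining labels either
-- all go to a single subtree or are split between two subtrees.
trees : ℕ → List ℕ → List PTree
trees _       []      = []
trees zero    (_ ∷ _) = []
trees (suc k) (m ∷ S) = leafIf m S ++ map (node₁ m) (trees k S) ++ concatMap (forks m (trees k)) (splits S)

count : ℕ → List ℕ → ℕ
count k S = length (trees k S)

leaves : ℕ → List ℕ → ℕ
leaves k S = total leafCount (trees k S)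

splitCount : ℕ → List ℕ × List ℕ → ℕ
splitCount k (A , B) = count k A * count k B

splitLeaves : ℕ → List ℕ × List ℕ → ℕ
splitLeaves k (A , B) = leaves k A * count k B + count k A * leaves k B

forksCount : ℕ → List ℕ → ℕ
forksCount k S = total (splitCount k) (splits S)

forksLeaves : ℕ → List ℕ → ℕ
forksLeaves k S = total (splitLeaves k) (splits S)

length-leafIf : ∀ m S → length (leafIf m S) ≡ onlyRoot S
length-leafIf m []      = refl
length-leafIf m (_ ∷ _) = refl

leaves-leafIf : ∀ m S → total leafCount (leafIf m S) ≡ onlyRoot S
leaves-leafIf m []      = refl
leaves-leafIf m (_ ∷ _) = refl

count-step : ∀ k m S → count (suc k) (m ∷ S) ≡ onlyRoot S + (count k S + forksCount k S)
count-step k m S = begin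
  length (leafIf m S ++ map (node₁ m) (trees k S) ++ concatMap (forks m (trees k)) (splits S))
    ≡⟨ length-++ (leafIf m S) ⟩
  length (leafIf m S) + length (map (node₁ m) (trees k S) ++ concatMap (forks m (trees k)) (splits S))
    ≡⟨ cong₂ _+_ (length-leafIf m S) (length-++ (map (node₁ m) (trees k S))) ⟩
  onlyRoot S + (length (map (node₁ m) (trees k S)) + length (concatMap (forks m (trees k)) (splits S)))
    ≡⟨ cong (onlyRoot S +_) (cong₂ _+_ (length-map (node₁ m) (trees k S)) forkPart) ⟩
  onlyRoot S + (count k S + forksCount k S) ∎
  where
  open ≡-Reasoning
  forkPart : length (concatMap (forks m (trees k)) (splits S)) ≡ forksCount k S
  forkPart = trans (length-concatMap (forks m (trees k)) (splits S))
    (total-cong (λ (A , B) → length-cartesianProductWith (node₂ m) (trees k A) (trees k B)) (splits S))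

leaves-step : ∀ k m S → leaves (suc k) (m ∷ S) ≡ onlyRoot S + (leaves k S + forksLeaves k S)
leaves-step k m S = begin
  total leafCount (leafIf m S ++ map (node₁ m) (trees k S) ++ concatMap (forks m (trees k)) (splits S))
    ≡⟨ total-++ leafCount (leafIf m S) _ ⟩
  total leafCount (leafIf m S) + total leafCount (map (node₁ m) (trees k S) ++ concatMap (forks m (trees k)) (splits S))
    ≡⟨ cong₂ _+_ (leaves-leafIf m S) (total-++ leafCount (map (node₁ m) (trees k S)) _) ⟩
  onlyRoot S + (total leafCount (map (node₁ m) (trees k S)) + total leafCount (concatMap (forks m (trees k)) (splits S)))
    ≡⟨ cong (onlyRoot S +_) (cong₂ _+_ (total-map leafCount (node₁ m) (trees k S)) forkPart) ⟩
  onlyRoot S + (leaves k S + forksLeaves k S) ∎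
  where
  open ≡-Reasoning
  forkPart : total leafCount (concatMap (forks m (trees k)) (splits S)) ≡ forksLeaves k S
  forkPart = trans (total-concatMap leafCount (forks m (trees k)) (splits S))
    (total-cong (λ (A , B) → total-cartesianProductWith (node₂ m) leafCount leafCount leafCount
                               (λ _ _ → refl) (trees k A) (trees k B)) (splits S))

Descending : List ℕ → Set
Descending = AllPairs _>_

descending⇒unique : ∀ {S} → Descending S → Unique S
descending⇒unique = AllPairs.map >⇒≢

label∈labels : ∀ t → label t ∈ labels t
label∈labels (leaf _)      = here refl
label∈labels (node₁ _ _)   = here refl
label∈labels (node₂ _ _ _) = here refl

labels≢[] : ∀ t → ¬ (labels t ≡ [])
labels≢[] (leaf _)      ()
labels≢[] (node₁ _ _)   ()
labels≢[] (node₂ _ _ _) ()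

labels≤label : ∀ t → Decreasing t → All (_≤ label t) (labels t)
labels≤label (leaf a)      _                   = ≤-refl ∷ []
labels≤label (node₁ a t)   (t<a , dt)          = ≤-refl ∷ All.map (λ b≤ → ≤-trans b≤ (<⇒≤ t<a)) (labels≤label t dt)
labels≤label (node₂ a l r) (l<a , r<a , dl , dr) =
  ≤-refl ∷ AllP.++⁺ (All.map (λ b≤ → ≤-trans b≤ (<⇒≤ l<a)) (labels≤label l dl))
                    (All.map (λ b≤ → ≤-trans b≤ (<⇒≤ r<a)) (labels≤label r dr))

root-label : ∀ {m S} t → All (m >_) S → labels t ↭ m ∷ S → Decreasing t → label t ≡ m
root-label t m>S p dt with ∈-resp-↭ p (label∈labels t)
... | here root≡m  = root≡m
... | there root∈S =
  ⊥-elim (<⇒≱ (All.lookup m>S root∈S) (All.lookup (labels≤label t dt) (∈-resp-↭ (↭-sym p) (here refl))))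

data RootView (k m : ℕ) (S : List ℕ) : PTree → Set where
  asLeaf  : S ≡ [] → RootView k m S (leaf m)
  asUnary : ∀ {t} → t ∈ trees k S → RootView k m S (node₁ m t)
  asFork  : ∀ {A B l r} → (A , B) ∈ splits S → l ∈ trees k A → r ∈ trees k B → RootView k m S (node₂ m l r)

∈-leafIf⁻ : ∀ {m S t} → t ∈ leafIf m S → S ≡ [] × t ≡ leaf m
∈-leafIf⁻ {S = []} (here refl) = refl , refl

∈-forks⁻ : ∀ {m enum qs t} → t ∈ concatMap (forks m enum) qs →
           ∃ λ q → q ∈ qs × ∃₂ λ l r → l ∈ enum (proj₁ q) × r ∈ enum (proj₂ q) × t ≡ node₂ m l r
∈-forks⁻ {m} {enum} {qs} t∈ with (A , B) , q∈ , t∈AB ← find (∈-concatMap⁻ (forks m enum) {xs = qs} t∈) =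
  (A , B) , q∈ , ∈-cartesianProductWith⁻ (node₂ m) (enum A) (enum B) t∈AB

rootView : ∀ {k m S t} → t ∈ trees (suc k) (m ∷ S) → RootView k m S t
rootView {k} {m} {S} t∈ with ∈-++⁻ (leafIf m S) t∈
... | inj₁ t∈leaf with refl , refl ← ∈-leafIf⁻ t∈leaf = asLeaf refl
... | inj₂ t∈rest with ∈-++⁻ (map (node₁ m) (trees k S)) t∈rest
...   | inj₁ t∈unary with _ , t′∈ , refl ← ∈-map⁻ (node₁ m) t∈unary = asUnary t′∈
...   | inj₂ t∈fork with _ , q∈ , _ , _ , l∈ , r∈ , refl ← ∈-forks⁻ {m} {trees k} {splits S} t∈fork = asFork q∈ l∈ r∈

fromRootView : ∀ {k m S t} → RootView k m S t → t ∈ trees (suc k) (m ∷ S)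
fromRootView {k} {m} {S} (asLeaf refl) = here refl
fromRootView {k} {m} {S} (asUnary t∈) = ∈-++⁺ʳ (leafIf m S) (∈-++⁺ˡ (∈-map⁺ (node₁ m) t∈))
fromRootView {k} {m} {S} (asFork q∈ l∈ r∈) =
  ∈-++⁺ʳ (leafIf m S) (∈-++⁺ʳ (map (node₁ m) (trees k S))
    (∈-concatMap⁺ (forks m (trees k)) (lose q∈ (∈-cartesianProductWith⁺ (node₂ m) l∈ r∈))))

trees-labels : ∀ k S {t} → t ∈ trees k S → labels t ↭ S
trees-labels (suc k) (m ∷ S) t∈ with rootView {k} {m} {S} t∈
... | asLeaf refl   = ↭-refl
... | asUnary t′∈   = ↭-prep m (trees-labels k S t′∈)
... | asFork {A} {B} q∈ l∈ r∈ =
  ↭-prep m (↭-trans (++⁺ (trees-labels k A l∈) (trees-labels k B r∈))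
                    (↭-sym (toPermutation (All.lookup (splits-interleaving S) q∈))))

root-below : ∀ {k m S t} → All (m >_) S → t ∈ trees k S → label t < m
root-below {k} {S = S} {t} m>S t∈ = All.lookup m>S (∈-resp-↭ (trees-labels k S t∈) (label∈labels t))

trees-decreasing : ∀ k S {t} → Descending S → t ∈ trees k S → Decreasing t
trees-decreasing (suc k) (m ∷ S) (m>S ∷ desc) t∈ with rootView {k} {m} {S} t∈
... | asLeaf refl = tt
... | asUnary t′∈ = root-below m>S t′∈ , trees-decreasing k S desc t′∈
... | asFork {A} {B} q∈ l∈ r∈ =
  let i = All.lookup (splits-interleaving S) q∈
      m>A , m>B = All-interleaving m>S i
      descA , descB = AllPairs-interleaving desc i
  in  root-below m>A l∈ , root-below m>B r∈ , trees-decreasing k A descA l∈ , trees-decreasing k B descB r∈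

trees-complete : ∀ k S t → length S ≤ k → Descending S → labels t ↭ S → Decreasing t → t ∈ trees k S
trees-complete k       []      t _ _ p _ = ⊥-elim (labels≢[] t (↭-empty-inv p))
trees-complete (suc k) (m ∷ S) t (s≤s |S|≤k) (m>S ∷ desc) p dt with root-label t m>S p dt
trees-complete (suc k) (m ∷ S) (leaf m) _ _ p _ | refl
  with refl ← ↭-singleton-inv (↭-sym p) = fromRootView {k} {m} {S} (asLeaf refl)
trees-complete (suc k) (m ∷ S) (node₁ m t) (s≤s |S|≤k) (m>S ∷ desc) p (_ , dt) | refl =
  fromRootView {k} {m} {S} (asUnary (trees-complete k S t |S|≤k desc (drop-∷ p) dt))
trees-complete (suc k) (m ∷ S) (node₂ m l r) (s≤s |S|≤k) (m>S ∷ desc) p (_ , _ , dl , dr) | refl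
  with A , B , i , pl , pr ← ↭⇒interleaving S (drop-∷ p) =
  let descA , descB = AllPairs-interleaving desc i
      |S|≡ = interleave-length i
  in  fromRootView {k} {m} {S} (asFork (interleaving∈splits i)
        (trees-complete k A l (≤-trans (subst (length A ≤_) (sym |S|≡) (m≤m+n _ _)) |S|≤k) descA pl dl)
        (trees-complete k B r (≤-trans (subst (length B ≤_) (sym |S|≡) (m≤n+m _ _)) |S|≤k) descB pr dr))

arity : PTree → ℕ
arity (leaf _)      = 0
arity (node₁ _ _)   = 1
arity (node₂ _ _ _) = 2

disjoint-by : {A B : Set} {xs ys : List A} (f : A → B) {a b : B} → ¬ (a ≡ b) →
              (∀ {x} → x ∈ xs → f x ≡ a) → (∀ {y} → y ∈ ys → f y ≡ b) → Disjoint xs ys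
disjoint-by f a≢b fxs fys (x∈xs , x∈ys) = a≢b (trans (sym (fxs x∈xs)) (fys x∈ys))

arity-leafIf : ∀ {m S t} → t ∈ leafIf m S → arity t ≡ 0
arity-leafIf t∈ with _ , refl ← ∈-leafIf⁻ t∈ = refl

arity-unary : ∀ {m ts t} → t ∈ map (node₁ m) ts → arity t ≡ 1
arity-unary {m} t∈ with _ , _ , refl ← ∈-map⁻ (node₁ m) t∈ = refl

arity-forks : ∀ {m enum qs t} → t ∈ concatMap (forks m enum) qs → arity t ≡ 2
arity-forks {m} {enum} {qs} t∈ with _ , _ , _ , _ , _ , _ , refl ← ∈-forks⁻ {m} {enum} {qs} t∈ = refl

-- Two-child trees over splits whose left parts are not rearrangements are distinct:
-- the labels of the left subtree determine the left part.
forks-disjoint : ∀ k m {q q′} → ¬ (proj₁ q ↭ proj₁ q′) → Disjoint (forks m (trees k) q) (forks m (trees k) q′)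
forks-disjoint k m {A , B} {A′ , B′} A≭A′ (t∈ , t∈′)
  with l , _ , l∈ , _ , refl ← ∈-cartesianProductWith⁻ (node₂ m) (trees k A) (trees k B) t∈
     | l′ , _ , l∈′ , _ , refl ← ∈-cartesianProductWith⁻ (node₂ m) (trees k A′) (trees k B′) t∈′ =
  A≭A′ (↭-trans (↭-sym (trees-labels k A l∈)) (trees-labels k A′ l∈′))

trees-unique : ∀ k S → Descending S → Unique (trees k S)
trees-unique k       []      _ = []
trees-unique zero    (_ ∷ _) _ = []
trees-unique (suc k) (m ∷ S) (_ ∷ desc) =
  UniqueP.++⁺ (leafIf-unique S) (UniqueP.++⁺ unary-unique forks-unique unary#forks) leaf#rest
  where
  leafIf-unique : ∀ S → Unique (leafIf m S)
  leafIf-unique []      = [] ∷ []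
  leafIf-unique (_ ∷ _) = []
  unary-unique : Unique (map (node₁ m) (trees k S))
  unary-unique = UniqueP.map⁺ (λ { refl → refl }) (trees-unique k S desc)
  forks-unique : Unique (concatMap (forks m (trees k)) (splits S))
  forks-unique = UniqueP.concat⁺
    (AllP.map⁺ (All.map (λ i → let descA , descB = AllPairs-interleaving desc i in
                                 UniqueP.cartesianProductWith⁺ (node₂ m) (λ { refl → refl , refl })
                                   (trees-unique k _ descA) (trees-unique k _ descB))
                        (splits-interleaving S)))
    (AllPairsP.map⁺ (AllPairs.map (λ {q} {q′} → forks-disjoint k m {q} {q′})
                                  (splits-separated (descending⇒unique desc))))
  unary#forks : Disjoint (map (node₁ m) (trees k S)) (concatMap (forks m (trees k)) (splits S))
  unary#forks = disjoint-by arity (λ ()) arity-unary (arity-forks {m} {trees k} {splits S})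
  leaf#rest : Disjoint (leafIf m S) (map (node₁ m) (trees k S) ++ concatMap (forks m (trees k)) (splits S))
  leaf#rest (t∈leaf , t∈rest) with ∈-++⁻ (map (node₁ m) (trees k S)) t∈rest
  ... | inj₁ t∈unary = disjoint-by arity (λ ()) arity-leafIf arity-unary (t∈leaf , t∈unary)
  ... | inj₂ t∈fork  = disjoint-by arity (λ ()) arity-leafIf (arity-forks {m} {trees k} {splits S}) (t∈leaf , t∈fork)

count-zero : ∀ S → count 0 S ≡ 0
count-zero []      = refl
count-zero (_ ∷ _) = refl

count-mono : ∀ k S → count k S ≤ count (suc k) S
count-mono zero    S       = ≤-trans (≤-reflexive (count-zero S)) z≤n
count-mono (suc k) []      = z≤n
count-mono (suc k) (m ∷ S) = begin
  count (suc k) (m ∷ S)                                 ≡⟨ count-step k m S ⟩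
  onlyRoot S + (count k S + forksCount k S)             ≤⟨ +-monoʳ-≤ (onlyRoot S) (+-mono-≤ (count-mono k S) forksMono) ⟩
  onlyRoot S + (count (suc k) S + forksCount (suc k) S) ≡⟨ count-step (suc k) m S ⟨
  count (suc (suc k)) (m ∷ S)                           ∎
  where
  open ≤-Reasoning
  forksMono = total-mono-≤ (λ (A , B) → *-mono-≤ (count-mono k A) (count-mono k B)) (splits S)

count-unary≤ : ∀ k m S → onlyRoot S + count k S ≤ count (suc k) (m ∷ S)
count-unary≤ k m S = begin
  onlyRoot S + count k S                    ≤⟨ +-monoʳ-≤ (onlyRoot S) (m≤m+n _ _) ⟩
  onlyRoot S + (count k S + forksCount k S) ≡⟨ count-step k m S ⟨
  count (suc k) (m ∷ S)                     ∎
  where open ≤-Reasoning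

leafCount-pos : ∀ t → 1 ≤ leafCount t
leafCount-pos (leaf _)      = s≤s z≤n
leafCount-pos (node₁ _ t)   = leafCount-pos t
leafCount-pos (node₂ _ l r) = ≤-trans (leafCount-pos l) (m≤m+n _ _)

length≤leaves : ∀ ts → length ts ≤ total leafCount ts
length≤leaves []       = z≤n
length≤leaves (t ∷ ts) = +-mono-≤ (leafCount-pos t) (length≤leaves ts)

-- On at least two labels, there are at most as many trees as there are trees whose root
-- has two children: attach the largest label y to the left subtree of a tree over the
-- remaining labels, as a new root (of a single vertex, or above a one-child root).
count≤forks : ∀ k y z R → count k (y ∷ z ∷ R) ≤ forksCount k (y ∷ z ∷ R)
count≤forks zero    y z R = z≤n
count≤forks (suc j) y z R = begin
  count (suc j) (y ∷ S)                                       ≡⟨ count-step j y S ⟩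
  count j S + forksCount j S                                  ≤⟨ +-mono-≤ leafLeft unaryLeft ⟩
  total f₁ (splits S) + total f₂ (splits S)                   ≡⟨ total-+ f₁ f₂ (splits S) ⟨
  total (λ q → f₁ q + f₂ q) (splits S)                        ≤⟨ total-mono-≤ extend (splits S) ⟩
  total (λ q → splitCount (suc j) (map₁ (y ∷_) q)) (splits S) ≡⟨ total-map (splitCount (suc j)) (map₁ (y ∷_)) (splits S) ⟨
  total (splitCount (suc j)) yLeft                            ≤⟨ m≤m+n _ _ ⟩
  total (splitCount (suc j)) yLeft + total (splitCount (suc j)) yRight
                                                              ≡⟨ total-++ (splitCount (suc j)) yLeft yRight ⟨
  forksCount (suc j) (y ∷ S)                                  ∎
  where
  open ≤-Reasoning
  S = z ∷ R
  yLeft yRight : List (List ℕ × List ℕ)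
  yLeft  = map (map₁ (y ∷_)) (splits S)
  yRight = map (map₂ (y ∷_)) (splits S)
  -- left subtree: the single vertex y, resp. y above a tree on A
  f₁ f₂ : List ℕ × List ℕ → ℕ
  f₁ (A , B) = onlyRoot A * count (suc j) B
  f₂ (A , B) = count j A * count (suc j) B
  leafLeft : count j S ≤ total f₁ (splits S)
  leafLeft = ≤-trans (count-mono j S)
    (≤-trans (≤-reflexive (sym (+-identityʳ _))) (∈⇒≤total f₁ (interleaving∈splits (allRight S))))
  unaryLeft : forksCount j S ≤ total f₂ (splits S)
  unaryLeft = total-mono-≤ (λ (A , B) → *-monoʳ-≤ (count j A) (count-mono j B)) (splits S)
  extend : ∀ q → f₁ q + f₂ q ≤ splitCount (suc j) (map₁ (y ∷_) q)
  extend (A , B) = begin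
    onlyRoot A * count (suc j) B + count j A * count (suc j) B ≡⟨ *-distribʳ-+ (count (suc j) B) (onlyRoot A) _ ⟨
    (onlyRoot A + count j A) * count (suc j) B                 ≤⟨ *-monoˡ-≤ (count (suc j) B) (count-unary≤ j y A) ⟩
    count (suc j) (y ∷ A) * count (suc j) B                    ∎

Bound : ℕ → List ℕ → Set
Bound k S = (2 + length S) * count k S ≤ 4 * leaves k S

-- Combining bounds for the two subtrees of a root: with x, y trees and la, lb leaves on a
-- and b labels, the x * y pairs carry la * y + x * lb leaves.
pair-bound : ∀ a b x y la lb → (2 + a) * x ≤ 4 * la → (2 + b) * y ≤ 4 * lb →
             (4 + (a + b)) * (x * y) ≤ 4 * (la * y + x * lb)
pair-bound a b x y la lb boundA boundB = begin
  (4 + (a + b)) * (x * y)              ≡⟨ solve 4 (λ a b x y → (con 4 :+ (a :+ b)) :* (x :* y)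
                                            := ((con 2 :+ a) :* x) :* y :+ x :* ((con 2 :+ b) :* y)) refl a b x y ⟩
  ((2 + a) * x) * y + x * ((2 + b) * y) ≤⟨ +-mono-≤ (*-monoˡ-≤ y boundA) (*-monoʳ-≤ x boundB) ⟩
  (4 * la) * y + x * (4 * lb)          ≡⟨ solve 4 (λ la y x lb → (con 4 :* la) :* y :+ x :* (con 4 :* lb)
                                            := con 4 :* (la :* y :+ x :* lb)) refl la y x lb ⟩
  4 * (la * y + x * lb)                ∎
  where open ≤-Reasoning

forks-bound : ∀ k → (∀ S → Bound k S) → ∀ S →
              (4 + length S) * forksCount k S ≤ 4 * forksLeaves k S
forks-bound k bound S = begin
  (4 + length S) * forksCount k S                          ≡⟨ total-scale (4 + length S) (splitCount k) (splits S) ⟨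
  total (λ q → (4 + length S) * splitCount k q) (splits S) ≤⟨ total-mono (All.map perSplit (splits-interleaving S)) ⟩
  total (λ q → 4 * splitLeaves k q) (splits S)             ≡⟨ total-scale 4 (splitLeaves k) (splits S) ⟩
  4 * forksLeaves k S                                      ∎
  where
  open ≤-Reasoning
  perSplit : ∀ {q} → Interleaving (proj₁ q) (proj₂ q) S → (4 + length S) * splitCount k q ≤ 4 * splitLeaves k q
  perSplit {A , B} i rewrite interleave-length i =
    pair-bound (length A) (length B) (count k A) (count k B) (leaves k A) (leaves k B) (bound A) (bound B)

-- Arithmetic of the inductive step when one label remains besides the root: every one of the
-- t one-child trees has a leaf (t ≤ l), and the two-child trees satisfy their own bound.
one-child-step : ∀ t l P Q → t ≤ l → 5 * P ≤ 4 * Q → 4 * (t + P) ≤ 4 * (l + Q)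
one-child-step t l P Q t≤l forksP = begin
  4 * (t + P)   ≡⟨ *-distribˡ-+ 4 t P ⟩
  4 * t + 4 * P ≤⟨ +-mono-≤ (*-monoʳ-≤ 4 t≤l) (≤-trans (*-monoˡ-≤ P (n≤1+n 4)) forksP) ⟩
  4 * l + 4 * Q ≡⟨ *-distribˡ-+ 4 l Q ⟨
  4 * (l + Q)   ∎
  where open ≤-Reasoning

many-children-step : ∀ p t l P Q → t ≤ P → (2 + p) * t ≤ 4 * l → (4 + p) * P ≤ 4 * Q →
                     (3 + p) * (t + P) ≤ 4 * (l + Q)
many-children-step p t l P Q t≤P unaryT forksP = begin
  (3 + p) * (t + P)           ≡⟨ solve 3 (λ p t P → (con 3 :+ p) :* (t :+ P)
                                   := (con 2 :+ p) :* t :+ (t :+ (con 3 :+ p) :* P)) refl p t P ⟩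
  (2 + p) * t + (t + (3 + p) * P) ≤⟨ +-monoʳ-≤ ((2 + p) * t) (+-monoˡ-≤ ((3 + p) * P) t≤P) ⟩
  (2 + p) * t + (4 + p) * P   ≤⟨ +-mono-≤ unaryT forksP ⟩
  4 * l + 4 * Q               ≡⟨ *-distribˡ-+ 4 l Q ⟨
  4 * (l + Q)                 ∎
  where open ≤-Reasoning

root-bound : ∀ k m x S →
  (3 + length (x ∷ S)) * (count k (x ∷ S) + forksCount k (x ∷ S)) ≤ 4 * (leaves k (x ∷ S) + forksLeaves k (x ∷ S)) →
  Bound (suc k) (m ∷ x ∷ S)
root-bound k m x S children = begin
  (3 + length S₁) * count (suc k) (m ∷ S₁)         ≡⟨ cong ((3 + length S₁) *_) (count-step k m S₁) ⟩
  (3 + length S₁) * (count k S₁ + forksCount k S₁) ≤⟨ children ⟩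
  4 * (leaves k S₁ + forksLeaves k S₁)             ≡⟨ cong (4 *_) (leaves-step k m S₁) ⟨
  4 * leaves (suc k) (m ∷ S₁)                      ∎
  where
  open ≤-Reasoning
  S₁ = x ∷ S

bound : ∀ k S → Bound k S
bound zero    S               = begin
  (2 + length S) * count 0 S ≡⟨ cong ((2 + length S) *_) (count-zero S) ⟩
  (2 + length S) * 0         ≡⟨ *-zeroʳ (2 + length S) ⟩
  0                          ≤⟨ z≤n ⟩
  4 * leaves 0 S             ∎
  where open ≤-Reasoning
bound (suc k) []              = z≤n
bound (suc k) (m ∷ [])        = s≤s (s≤s (s≤s z≤n))
bound (suc k) (m ∷ x ∷ [])    =
  root-bound k m x [] (one-child-step (count k S) (leaves k S) (forksCount k S) (forksLeaves k S)
                                      (length≤leaves (trees k S)) (forks-bound k (bound k) S))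
  where S = x ∷ []
bound (suc k) (m ∷ x ∷ y ∷ R) =
  root-bound k m x (y ∷ R) (many-children-step (length S) (count k S) (leaves k S) (forksCount k S) (forksLeaves k S)
                                               (count≤forks k x y R) (bound k S) (forks-bound k (bound k) S))
  where S = x ∷ y ∷ R

same-members⇒↭ : {A : Set} {xs ys : List A} → Unique xs → Unique ys → (∀ {x} → x ∈ xs ⇔ x ∈ ys) → xs ↭ ys
same-members⇒↭ xs-unique ys-unique same = ∼bag⇒↭ (unique∧set⇒bag xs-unique ys-unique same)

descending : ℕ → List ℕ
descending n = map suc (downFrom n)

length-descending : ∀ n → length (descending n) ≡ n
length-descending n = trans (length-map suc (downFrom n)) (length-downFrom n)

descending-below : ∀ n → All (suc n >_) (descending n)
descending-below zero    = []
descending-below (suc n) = n<1+n (suc n) ∷ All.map m<n⇒m<1+n (descending-below n)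

descending-descending : ∀ n → Descending (descending n)
descending-descending zero    = []
descending-descending (suc n) = descending-below n ∷ descending-descending n

[n]↭descending : ∀ n → [ n ] ↭ descending n
[n]↭descending n = map⁺ suc (↭-trans (↭-sym (↭-reverse (upTo n))) (↭-reflexive (reverse-upTo n)))

∈-trees⇔labeled : ∀ n {t} → t ∈ trees n (descending n) ⇔ IsLabeled12Tree n t
∈-trees⇔labeled n {t} = mk⇔
  (λ t∈ → ↭-trans (trees-labels n D t∈) (↭-sym ([n]↭descending n)) , trees-decreasing n D D-desc t∈)
  (λ (labels↭ , decreasing) →
     trees-complete n D t (≤-reflexive (length-descending n)) D-desc (↭-trans labels↭ ([n]↭descending n)) decreasing)
  where
  D = descending n
  D-desc = descending-descending n

proposition3p3 : (n : ℕ) → 1 ≤ n → (ts : List PTree) → Unique ts →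
  (∀ t → (t ∈ ts) ⇔ IsLabeled12Tree n t) →
  n * length ts ≤ 4 * sum (map leafCount ts)
proposition3p3 n _ ts ts-unique ts-labeled = begin
  n * length ts              ≡⟨ cong (n *_) (↭-length ts↭E) ⟩
  n * count n D              ≤⟨ *-monoˡ-≤ (count n D) (m≤n+m n 2) ⟩
  (2 + n) * count n D        ≡⟨ cong (λ p → (2 + p) * count n D) (length-descending n) ⟨
  (2 + length D) * count n D ≤⟨ bound n D ⟩
  4 * leaves n D             ≡⟨ cong (4 *_) (sum-↭ (map⁺ leafCount ts↭E)) ⟨
  4 * sum (map leafCount ts) ∎
  where
  open ≤-Reasoning
  D = descending n
  ts↭E : ts ↭ trees n D
  ts↭E = same-members⇒↭ ts-unique (trees-unique n D (descending-descending n))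
           (λ {t} → ⇔.trans (ts-labeled t) (⇔.sym (∈-trees⇔labeled n)))
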